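{- Let $\mathbf{n}=(n_1,n_2)$ with $n_1,n_2$ positive integers. Let $\mu_3(\mathbf{n})$ denote the maximum size of a subset $S\subseteq [n_1]\times[n_2]$ such that there are no elements $\mathbf{a}_1,\mathbf{a}_2,\mathbf{a}_3\in S$ (not necessarily distinct) with $\mathbf{a}_1+\mathbf{a}_2+\mathbf{a}_3=\mathbf{n}$. Then, as both $n_1$ and $n_2$ go to infinity, \[\mu_3(\mathbf{n})\le \frac{7}{9}\,n_1n_2+O\big(\max\{n_1,n_2\}\big).\]
   Context: For a positive integer $n$, $[n]=\{1,\ldots,n\}$. Addition of lattice points is coordinatewise. -}

module Defs where

open import Data.Nat using (ℕ; _+_; _≤_)
open import Data.Product using (_×_; _,_)
open import Data.List using (List; length)
open import Data.List.Membership.Propositional using (_∈_)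
open import Data.List.Relation.Unary.All using (All)
open import Data.List.Relation.Unary.Unique.Propositional using (Unique)
open import Relation.Binary.PropositionalEquality using (_≡_)
open import Relation.Nullary using (¬_)

Point : Set
Point = ℕ × ℕ

_⊕_ : Point → Point → Point
(x₁ , y₁) ⊕ (x₂ , y₂) = (x₁ + x₂ , y₁ + y₂)

InGrid : ℕ → ℕ → Point → Set
InGrid n₁ n₂ (x , y) = (1 ≤ x × x ≤ n₁) × (1 ≤ y × y ≤ n₂)

-- A finite set S ⊆ [n₁]×[n₂] is represented by a duplicate-free list;
-- its size is the length of the list.
IsSubsetOfGrid : ℕ → ℕ → List Point → Set
IsSubsetOfGrid n₁ n₂ S = Unique S × All (InGrid n₁ n₂) S

Avoids3 : Point → List Point → Set
Avoids3 n S = ∀ {a₁ a₂ a₃} → a₁ ∈ S → a₂ ∈ S → a₃ ∈ S → ¬ ((a₁ ⊕ a₂) ⊕ a₃ ≡ n)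

Admissible3 : ℕ → ℕ → List Point → Set
Admissible3 n₁ n₂ S = IsSubsetOfGrid n₁ n₂ S × Avoids3 (n₁ , n₂) S

-- Count S by columns: c x = #{y | (x , y) ∈ S}. If i + j + k = n₁, the columns i, j, k are
-- three subsets of [n₂] with no y₁ + y₂ + y₃ = n₂, and such sets have at most 2n₂ + 2 elements
-- in total. Writing n₁ = 9L + 4 + D, one can pack 2L disjoint triples i + j + k = n₁ into [n₁],
-- covering 6L columns; these carry at most two thirds of n₂ each on average and the remaining
-- 3L + 4 + D columns at most n₂ each, which gives 9|S| ≤ 7n₁n₂ + O(n₁ + n₂).
module Submission where

open import Defs
open import Data.Bool using (if_then_else_)
open import Data.Nat using (ℕ; zero; suc; _+_; _*_; _≤_; _⊔_; _∸_; pred; z≤n; s≤s; _≟_)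
open import Data.Nat.Properties
open import Data.Nat.DivMod using (_/_; _%_; m≡m%n+[m/n]*n; m%n<n)
open import Data.Nat.Tactic.RingSolver using (solve-∀)
open import Data.Product using (∃₂; _,_; _×_)
open import Data.Product.Properties using (≡-dec)
open import Data.Sum using (_⊎_; inj₁; inj₂)
open import Data.List using (List; length; []; _∷_)
open import Data.List.Relation.Unary.All using (All; []; _∷_)
open import Data.List.Relation.Unary.AllPairs using ([]; _∷_)
open import Data.List.Relation.Unary.Any using (here; there)
open import Data.List.Membership.Propositional using (_∈_)
open import Data.List.Relation.Unary.Unique.Propositional using (Unique)
open import Relation.Binary.PropositionalEquality
open import Function using (_∘′_)
open import Relation.Nullary using (¬_; Dec; yes; no; ⌊_⌋; contradiction)

∑ : ℕ → (ℕ → ℕ) → ℕ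
∑ zero    f = 0
∑ (suc n) f = ∑ n f + f (suc n)

syntax ∑ n (λ x → e) = ∑[ x ≤ n ] e

∑-cong : ∀ n {f g : ℕ → ℕ} → (∀ {y} → 1 ≤ y → y ≤ n → f y ≡ g y) → ∑ n f ≡ ∑ n g
∑-cong zero    eq = refl
∑-cong (suc n) eq = cong₂ _+_ (∑-cong n λ 1≤y y≤n → eq 1≤y (m≤n⇒m≤1+n y≤n)) (eq (s≤s z≤n) ≤-refl)

∑-mono-≤ : ∀ n {f g : ℕ → ℕ} → (∀ {y} → 1 ≤ y → y ≤ n → f y ≤ g y) → ∑ n f ≤ ∑ n g
∑-mono-≤ zero    le = z≤n
∑-mono-≤ (suc n) le = +-mono-≤ (∑-mono-≤ n λ 1≤y y≤n → le 1≤y (m≤n⇒m≤1+n y≤n)) (le (s≤s z≤n) ≤-refl)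

∑-const : ∀ n c → ∑[ y ≤ n ] c ≡ n * c
∑-const zero    c = refl
∑-const (suc n) c = trans (cong (_+ c) (∑-const n c)) (+-comm (n * c) c)

∑-bounded : ∀ n c {f : ℕ → ℕ} → (∀ {y} → 1 ≤ y → y ≤ n → f y ≤ c) → ∑ n f ≤ n * c
∑-bounded n c le = ≤-trans (∑-mono-≤ n le) (≤-reflexive (∑-const n c))

∑-indicator : ∀ n {f : ℕ → ℕ} → (∀ y → f y ≤ 1) → ∑ n f ≤ n
∑-indicator n {f} f≤1 = subst (∑ n f ≤_) (*-identityʳ n) (∑-bounded n 1 λ {y} _ _ → f≤1 y)

∑-zero : ∀ n {f : ℕ → ℕ} → (∀ {y} → 1 ≤ y → y ≤ n → f y ≡ 0) → ∑ n f ≡ 0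
∑-zero n zeros = trans (∑-cong n zeros) (trans (∑-const n 0) (*-zeroʳ n))

∑-distrib-+ : ∀ n (f g : ℕ → ℕ) → ∑[ y ≤ n ] (f y + g y) ≡ ∑ n f + ∑ n g
∑-distrib-+ zero    f g = refl
∑-distrib-+ (suc n) f g = trans (cong (_+ (f (suc n) + g (suc n))) (∑-distrib-+ n f g))
                                (interchange (∑ n f) (∑ n g) (f (suc n)) (g (suc n)))
  where
  interchange : ∀ a b c d → a + b + (c + d) ≡ a + c + (b + d)
  interchange = solve-∀

∑-distribˡ-* : ∀ n c (f : ℕ → ℕ) → ∑[ y ≤ n ] (c * f y) ≡ c * ∑ n f
∑-distribˡ-* zero    c f = sym (*-zeroʳ c)
∑-distribˡ-* (suc n) c f = trans (cong (_+ c * f (suc n)) (∑-distribˡ-* n c f))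
                                 (sym (*-distribˡ-+ c (∑ n f) (f (suc n))))

∑-split : ∀ o a b (f : ℕ → ℕ) →
  ∑[ j ≤ a + b ] f (o + j) ≡ ∑[ j ≤ a ] f (o + j) + ∑[ j ≤ b ] f (o + a + j)
∑-split o a zero    f = trans (cong (λ k → ∑[ j ≤ k ] f (o + j)) (+-identityʳ a)) (sym (+-identityʳ _))
∑-split o a (suc b) f = begin
    ∑[ j ≤ a + suc b ] f (o + j)
  ≡⟨ cong (λ k → ∑[ j ≤ k ] f (o + j)) (+-suc a b) ⟩
    ∑[ j ≤ a + b ] f (o + j) + f (o + suc (a + b))
  ≡⟨ cong₂ _+_ (∑-split o a b f) (cong f (trans (cong (o +_) (sym (+-suc a b))) (sym (+-assoc o a (suc b))))) ⟩
    ∑[ j ≤ a ] f (o + j) + ∑[ j ≤ b ] f (o + a + j) + f (o + a + suc b)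
  ≡⟨ +-assoc (∑[ j ≤ a ] f (o + j)) _ _ ⟩
    ∑[ j ≤ a ] f (o + j) + ∑[ j ≤ suc b ] f (o + a + j) ∎
  where open ≡-Reasoning

∑-reverse : ∀ n (f : ℕ → ℕ) → ∑[ j ≤ n ] f (suc n ∸ j) ≡ ∑ n f
∑-reverse zero    f = refl
∑-reverse (suc n) f = begin
    ∑[ j ≤ n ] f (suc (suc n) ∸ j) + f (suc (suc n) ∸ suc n)
  ≡⟨ cong₂ _+_ (∑-cong n λ _ j≤n → cong f (+-∸-assoc 1 (m≤n⇒m≤1+n j≤n)))
               (cong f (m+n∸n≡m 1 n)) ⟩
    ∑[ j ≤ n ] f (suc (suc n ∸ j)) + f 1
  ≡⟨ cong (_+ f 1) (∑-reverse n (f ∘′ suc)) ⟩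
    ∑[ j ≤ n ] f (suc j) + f 1
  ≡⟨ +-comm _ (f 1) ⟩
    0 + f 1 + ∑[ j ≤ n ] f (1 + j)
  ≡⟨ sym (∑-split 0 1 n f) ⟩
    ∑ (suc n) f ∎
  where open ≡-Reasoning

∑-pairs : ∀ L (g : ℕ → ℕ) → ∑ (L + L) g ≡ ∑[ j ≤ L ] (g (pred (j + j)) + g (j + j))
∑-pairs zero    g = refl
∑-pairs (suc L) g rewrite +-suc L L | ∑-pairs L g =
  +-assoc (∑[ j ≤ L ] (g (pred (j + j)) + g (j + j))) (g (suc (L + L))) (g (suc (suc (L + L))))

∑-leading-zeros : ∀ p q {f : ℕ → ℕ} → (∀ y → f y ≤ 1) →
  (∀ {y} → 1 ≤ y → y ≤ p → f y ≡ 0) → ∑ (p + q) f ≤ q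
∑-leading-zeros p q {f} f≤1 zeros = begin
    ∑ (p + q) f
  ≡⟨ ∑-split 0 p q f ⟩
    ∑ p f + ∑[ j ≤ q ] f (p + j)
  ≡⟨ cong (_+ ∑[ j ≤ q ] f (p + j)) (∑-zero p zeros) ⟩
    ∑[ j ≤ q ] f (p + j)
  ≤⟨ ∑-indicator q (λ j → f≤1 (p + j)) ⟩
    q ∎
  where open ≤-Reasoning

∑-prefix : ∀ K q {f : ℕ → ℕ} → (∀ y → f y ≤ 1) → ∑ (K + q) f ≤ ∑ K f + q
∑-prefix K q {f} f≤1 = begin
    ∑ (K + q) f
  ≡⟨ ∑-split 0 K q f ⟩
    ∑ K f + ∑[ j ≤ q ] f (K + j)
  ≤⟨ +-monoʳ-≤ (∑ K f) (∑-indicator q (λ j → f≤1 (K + j))) ⟩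
    ∑ K f + q ∎
  where open ≤-Reasoning

∑-antipodal : ∀ K {f g : ℕ → ℕ} → (∀ {y} → 1 ≤ y → y ≤ K → f y + g (suc K ∸ y) ≤ 1) →
  ∑ K f + ∑ K g ≤ K
∑-antipodal K {f} {g} le = begin
    ∑ K f + ∑ K g
  ≡⟨ cong (∑ K f +_) (sym (∑-reverse K g)) ⟩
    ∑ K f + ∑[ y ≤ K ] g (suc K ∸ y)
  ≡⟨ sym (∑-distrib-+ K f (λ y → g (suc K ∸ y))) ⟩
    ∑[ y ≤ K ] (f y + g (suc K ∸ y))
  ≤⟨ ∑-bounded K 1 le ⟩
    K * 1
  ≡⟨ *-identityʳ K ⟩
    K ∎
  where open ≤-Reasoning

first-positive : ∀ m (f : ℕ → ℕ) →
  (∀ {y} → 1 ≤ y → y ≤ m → f y ≡ 0) ⊎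
  ∃₂ λ p r → p + suc r ≡ m × 1 ≤ f (suc p) × (∀ {y} → 1 ≤ y → y ≤ p → f y ≡ 0)
first-positive zero    f = inj₁ λ { (s≤s _) () }
first-positive (suc m) f with first-positive m f
... | inj₂ (p , r , p+r+1≡m , positive , zeros) =
  inj₂ (p , suc r , trans (+-suc p (suc r)) (cong suc p+r+1≡m) , positive , zeros)
... | inj₁ zeros with f (suc m) ≟ 0
...   | no  f[m+1]≢0 = inj₂ (m , 0 , +-comm m 1 , n≢0⇒n>0 f[m+1]≢0 , zeros)
...   | yes f[m+1]≡0 = inj₁ zeros′
  where
  zeros′ : ∀ {y} → 1 ≤ y → y ≤ suc m → f y ≡ 0
  zeros′ 1≤y y≤m+1 with m≤n⇒m<n∨m≡n y≤m+1
  ... | inj₁ y<m+1 = zeros 1≤y (≤-pred y<m+1)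
  ... | inj₂ refl  = f[m+1]≡0

+-≤1 : ∀ {a b} → a ≤ 1 → b ≤ 1 → ¬ (1 ≤ a × 1 ≤ b) → a + b ≤ 1
+-≤1 z≤n b≤1 _ = b≤1
+-≤1 {b = zero}  (s≤s z≤n) _ _    = s≤s z≤n
+-≤1 {b = suc _} (s≤s z≤n) _ both = contradiction (s≤s z≤n , s≤s z≤n) both

∑₃-bound-trivial : ∀ m {α β γ : ℕ → ℕ} → ∑ m α ≤ 2 → (∀ y → β y ≤ 1) → (∀ y → γ y ≤ 1) →
  ∑ m α + ∑ m β + ∑ m γ ≤ 2 * m + 2
∑₃-bound-trivial m α≤2 β≤1 γ≤1 =
  ≤-trans (+-mono-≤ (+-mono-≤ α≤2 (∑-indicator m β≤1)) (∑-indicator m γ≤1)) (≤-reflexive (2+m+m m))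
  where
  2+m+m : ∀ m → 2 + m + m ≡ 2 * m + 2
  2+m+m = solve-∀

-- The least element a = suc p of the first set pairs off y with m - a - y in the other two.
avoiding-∑-bound : ∀ m (α β γ : ℕ → ℕ) → (∀ y → α y ≤ 1) → (∀ y → β y ≤ 1) → (∀ y → γ y ≤ 1) →
  (∀ {y₁ y₂ y₃} → 1 ≤ α y₁ → 1 ≤ β y₂ → 1 ≤ γ y₃ → y₁ + y₂ + y₃ ≢ m) →
  ∑ m α + ∑ m β + ∑ m γ ≤ 2 * m + 2
avoiding-∑-bound m α β γ α≤1 β≤1 γ≤1 avoids with first-positive m α
... | inj₁ zeros =
  ∑₃-bound-trivial m (≤-trans (≤-reflexive (∑-zero m zeros)) z≤n) β≤1 γ≤1
... | inj₂ (p , 0 , refl , _ , zeros) =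
  ∑₃-bound-trivial m (≤-trans (∑-leading-zeros p 1 α≤1 zeros) (s≤s z≤n)) β≤1 γ≤1
... | inj₂ (p , suc K , refl , 1≤α[1+p] , zeros) = begin
    ∑ m α + ∑ m β + ∑ m γ
  ≤⟨ +-mono-≤ (+-mono-≤ (∑-leading-zeros p (2 + K) α≤1 zeros) (tail β≤1)) (tail γ≤1) ⟩
    (2 + K) + (∑ K β + (2 + p)) + (∑ K γ + (2 + p))
  ≡⟨ regroup K p (∑ K β) (∑ K γ) ⟩
    (∑ K β + ∑ K γ) + (2 + K + 2 * (2 + p))
  ≤⟨ +-monoˡ-≤ _ (∑-antipodal K antipodal) ⟩
    K + (2 + K + 2 * (2 + p))
  ≡⟨ total K p ⟩
    2 * m + 2 ∎
  where
  open ≤-Reasoning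
  m≡K+2+p : m ≡ K + (2 + p)
  m≡K+2+p = m≡ K p
    where m≡ : ∀ K p → p + (2 + K) ≡ K + (2 + p)
          m≡ = solve-∀
  tail : ∀ {f} → (∀ y → f y ≤ 1) → ∑ m f ≤ ∑ K f + (2 + p)
  tail {f} f≤1 = subst (λ k → ∑ k f ≤ ∑ K f + (2 + p)) (sym m≡K+2+p) (∑-prefix K (2 + p) f≤1)
  antipodal : ∀ {y} → 1 ≤ y → y ≤ K → β y + γ (suc K ∸ y) ≤ 1
  antipodal {y} _ y≤K = +-≤1 (β≤1 y) (γ≤1 (suc K ∸ y)) λ (βy , γy) → avoids 1≤α[1+p] βy γy (begin-equality
      suc p + y + (suc K ∸ y)   ≡⟨ +-assoc (suc p) y _ ⟩
      suc p + (y + (suc K ∸ y)) ≡⟨ cong (suc p +_) (m+[n∸m]≡n (m≤n⇒m≤1+n y≤K)) ⟩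
      suc p + suc K             ≡⟨ sym (+-suc p (suc K)) ⟩
      p + (2 + K)               ∎)
  regroup : ∀ K p b c → (2 + K) + (b + (2 + p)) + (c + (2 + p)) ≡ (b + c) + (2 + K + 2 * (2 + p))
  regroup = solve-∀
  total : ∀ K p → K + (2 + K + 2 * (2 + p)) ≡ 2 * (p + (2 + K)) + 2
  total = solve-∀

δ : ℕ → ℕ → ℕ
δ a b = if ⌊ a ≟ b ⌋ then 1 else 0

δ-refl : ∀ a → δ a a ≡ 1
δ-refl a with a ≟ a
... | yes _   = refl
... | no  a≢a = contradiction refl a≢a

δ-≢ : ∀ {a b} → a ≢ b → δ a b ≡ 0
δ-≢ {a} {b} a≢b with a ≟ b
... | yes a≡b = contradiction a≡b a≢b
... | no  _   = refl

∑-δ : ∀ m {b} → 1 ≤ b → b ≤ m → ∑[ y ≤ m ] δ b y ≡ 1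
∑-δ zero    (s≤s _) ()
∑-δ (suc m) {b} 1≤b b≤m+1 with m≤n⇒m<n∨m≡n b≤m+1
... | inj₁ b<m+1 = cong₂ _+_ (∑-δ m 1≤b (≤-pred b<m+1)) (δ-≢ (<⇒≢ b<m+1))
... | inj₂ refl  = cong₂ _+_ (∑-zero m λ _ y≤m → δ-≢ (>⇒≢ (s≤s y≤m))) (δ-refl (suc m))

δ² : Point → Point → ℕ
δ² (a , b) (x , y) = δ a x * δ b y

δ²-refl : ∀ p → δ² p p ≡ 1
δ²-refl (a , b) rewrite δ-refl a | δ-refl b = refl

δ²-≢ : ∀ {p q} → p ≢ q → δ² p q ≡ 0
δ²-≢ {a , b} {x , y} p≢q with a ≟ x
... | no  _    = refl
... | yes refl = trans (*-identityˡ (δ b y)) (δ-≢ λ b≡y → p≢q (cong (a ,_) b≡y))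

∑∑-δ² : ∀ n m {p} → InGrid n m p → ∑[ x ≤ n ] ∑[ y ≤ m ] δ² p (x , y) ≡ 1
∑∑-δ² n m {a , b} ((1≤a , a≤n) , (1≤b , b≤m)) = begin
    ∑[ x ≤ n ] ∑[ y ≤ m ] (δ a x * δ b y)
  ≡⟨ ∑-cong n (λ {x} _ _ → ∑-distribˡ-* m (δ a x) (δ b)) ⟩
    ∑[ x ≤ n ] (δ a x * ∑[ y ≤ m ] δ b y)
  ≡⟨ ∑-cong n (λ {x} _ _ → trans (cong (δ a x *_) (∑-δ m 1≤b b≤m)) (*-identityʳ (δ a x))) ⟩
    ∑[ x ≤ n ] δ a x
  ≡⟨ ∑-δ n 1≤a a≤n ⟩
    1 ∎
  where open ≡-Reasoning

multiplicity : List Point → Point → ℕ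
multiplicity []      q = 0
multiplicity (p ∷ S) q = δ² p q + multiplicity S q

multiplicity-∉ : ∀ {q} S → All (q ≢_) S → multiplicity S q ≡ 0
multiplicity-∉ []      []          = refl
multiplicity-∉ (p ∷ S) (q≢p ∷ q∉S) =
  cong₂ _+_ (δ²-≢ (λ p≡q → q≢p (sym p≡q))) (multiplicity-∉ S q∉S)

_≟ₚ_ : (p q : Point) → Dec (p ≡ q)
_≟ₚ_ = ≡-dec _≟_ _≟_

multiplicity-unique : ∀ {S} → Unique S → ∀ q → multiplicity S q ≤ 1
multiplicity-unique []                 q = z≤n
multiplicity-unique {p ∷ S} (p∉S ∷ uS) q with p ≟ₚ q
... | yes refl = ≤-reflexive (cong₂ _+_ (δ²-refl p) (multiplicity-∉ S p∉S))
... | no  p≢q  = subst (_≤ 1) (cong (_+ multiplicity S q) (sym (δ²-≢ p≢q))) (multiplicity-unique uS q)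

multiplicity-∈ : ∀ S {q} → 1 ≤ multiplicity S q → q ∈ S
multiplicity-∈ (p ∷ S) {q} positive with p ≟ₚ q
... | yes refl = here refl
... | no  p≢q  = there (multiplicity-∈ S (subst (1 ≤_) (cong (_+ multiplicity S q) (δ²-≢ p≢q)) positive))

∑∑-multiplicity : ∀ n m {S} → All (InGrid n m) S →
  ∑[ x ≤ n ] ∑[ y ≤ m ] multiplicity S (x , y) ≡ length S
∑∑-multiplicity n m []                 = ∑-zero n λ _ _ → ∑-zero m λ _ _ → refl
∑∑-multiplicity n m {p ∷ S} (p∈G ∷ S⊆G) = begin
    ∑[ x ≤ n ] ∑[ y ≤ m ] (δ² p (x , y) + multiplicity S (x , y))
  ≡⟨ ∑-cong n (λ {x} _ _ → ∑-distrib-+ m (λ y → δ² p (x , y)) (λ y → multiplicity S (x , y))) ⟩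
    ∑[ x ≤ n ] (∑[ y ≤ m ] δ² p (x , y) + ∑[ y ≤ m ] multiplicity S (x , y))
  ≡⟨ ∑-distrib-+ n _ _ ⟩
    ∑[ x ≤ n ] ∑[ y ≤ m ] δ² p (x , y) + ∑[ x ≤ n ] ∑[ y ≤ m ] multiplicity S (x , y)
  ≡⟨ cong₂ _+_ (∑∑-δ² n m p∈G) (∑∑-multiplicity n m S⊆G) ⟩
    suc (length S) ∎
  where open ≡-Reasoning

∑₃-bounded : ∀ L s (f g h : ℕ → ℕ) → (∀ {j} → 1 ≤ j → j ≤ L → f j + g j + h j ≤ s) →
  ∑ L f + ∑ L g + ∑ L h ≤ L * s
∑₃-bounded L s f g h le = begin
    ∑ L f + ∑ L g + ∑ L h
  ≡⟨ cong (_+ ∑ L h) (sym (∑-distrib-+ L f g)) ⟩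
    ∑[ j ≤ L ] (f j + g j) + ∑ L h
  ≡⟨ sym (∑-distrib-+ L (λ j → f j + g j) h) ⟩
    ∑[ j ≤ L ] (f j + g j + h j)
  ≤⟨ ∑-bounded L s le ⟩
    L * s ∎
  where open ≤-Reasoning

suc[j+r]∸j≡suc[r] : ∀ j r → suc (j + r) ∸ j ≡ suc r
suc[j+r]∸j≡suc[r] j r = trans (cong (_∸ j) (sym (+-suc j r))) (m+n∸m≡n j (suc r))

triple₁-sum : ∀ {j L} D → j ≤ L →
  j + (L + 1 + L + L + j) + (L + 1 + L + L + L + D + ((suc L ∸ j) + (suc L ∸ j))) ≡ 9 * L + 4 + D
triple₁-sum {j} D j≤L with m≤n⇒∃[o]m+o≡n j≤L
... | r , refl rewrite suc[j+r]∸j≡suc[r] j r = arithmetic j r D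
  where
  arithmetic : ∀ j r D → j + ((j + r) + 1 + (j + r) + (j + r) + j)
    + ((j + r) + 1 + (j + r) + (j + r) + (j + r) + D + (suc r + suc r)) ≡ 9 * (j + r) + 4 + D
  arithmetic = solve-∀

triple₂-sum : ∀ {j L} D → j ≤ L →
  (L + 1 + j) + (L + 1 + L + j) + (L + 1 + L + L + L + D + pred ((suc L ∸ j) + (suc L ∸ j))) ≡ 9 * L + 4 + D
triple₂-sum {j} D j≤L with m≤n⇒∃[o]m+o≡n j≤L
... | r , refl rewrite suc[j+r]∸j≡suc[r] j r = arithmetic j r D
  where
  arithmetic : ∀ j r D → ((j + r) + 1 + j) + ((j + r) + 1 + (j + r) + j)
    + ((j + r) + 1 + (j + r) + (j + r) + (j + r) + D + (r + suc r)) ≡ 9 * (j + r) + 4 + D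
  arithmetic = solve-∀

-- [n], n = 9L+4+D, is cut into blocks of lengths L, 1, L, L, L, D, 2L, 3L+3; the 2L triples
-- (j, 3L+1+j, n-3L-1-2j) and (L+1+j, 2L+1+j, n-3L-2-2j) use blocks 1, 3, 4, 5 and 7 exactly once.
∑-triple-packing : ∀ L D m s (c : ℕ → ℕ) → (∀ x → c x ≤ m) →
  (∀ {i j k} → i + j + k ≡ 9 * L + 4 + D → c i + c j + c k ≤ s) →
  ∑ (9 * L + 4 + D) c ≤ 2 * L * s + (3 * L + 4 + D) * m
∑-triple-packing L D m s c c≤m triple = begin
    ∑ (9 * L + 4 + D) c
  ≡⟨ blocks ⟩
    P₁ + (P₂ + (P₃ + (P₄ + (P₅ + (P₆ + (P₇ + P₈))))))
  ≡⟨ cong (λ t → P₁ + (P₂ + (P₃ + (P₄ + (P₅ + (P₆ + (t + P₈))))))) P₇≡A+B ⟩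
    P₁ + (P₂ + (P₃ + (P₄ + (P₅ + (P₆ + ((A + B) + P₈))))))
  ≡⟨ regroup P₁ P₂ P₃ P₄ P₅ P₆ P₈ A B ⟩
    (P₁ + P₅ + B) + (P₃ + P₄ + A) + (P₂ + P₆ + P₈)
  ≤⟨ +-mono-≤ (+-mono-≤ family₁ family₂) (+-mono-≤ (+-mono-≤ (bounded 1 L) (bounded D o₅)) (bounded (3 * L + 3) o₇)) ⟩
    L * s + L * s + (1 * m + D * m + (3 * L + 3) * m)
  ≡⟨ total L D m s ⟩
    2 * L * s + (3 * L + 4 + D) * m ∎
  where
  open ≤-Reasoning
  o₃ o₄ o₅ o₆ o₇ : ℕ
  o₃ = L + 1 + L
  o₄ = o₃ + L
  o₅ = o₄ + L
  o₆ = o₅ + D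
  o₇ = o₆ + (L + L)
  block : ℕ → ℕ → ℕ
  block o k = ∑[ j ≤ k ] c (o + j)
  P₁ P₂ P₃ P₄ P₅ P₆ P₇ P₈ A B : ℕ
  P₁ = block 0 L
  P₂ = block L 1
  P₃ = block (L + 1) L
  P₄ = block o₃ L
  P₅ = block o₄ L
  P₆ = block o₅ D
  P₇ = block o₆ (L + L)
  P₈ = block o₇ (3 * L + 3)
  A = ∑[ j ≤ L ] c (o₆ + pred ((suc L ∸ j) + (suc L ∸ j)))
  B = ∑[ j ≤ L ] c (o₆ + ((suc L ∸ j) + (suc L ∸ j)))
  bounded : ∀ k o → block o k ≤ k * m
  bounded k o = ∑-bounded k m (λ _ _ → c≤m _)
  lengths : ∀ L D → 9 * L + 4 + D ≡ L + (1 + (L + (L + (L + (D + ((L + L) + (3 * L + 3)))))))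
  lengths = solve-∀
  blocks : ∑ (9 * L + 4 + D) c ≡ P₁ + (P₂ + (P₃ + (P₄ + (P₅ + (P₆ + (P₇ + P₈))))))
  blocks = trans (cong (λ k → ∑ k c) (lengths L D))
    (trans (∑-split 0 L _ c) (cong (P₁ +_)
    (trans (∑-split L 1 _ c) (cong (P₂ +_)
    (trans (∑-split (L + 1) L _ c) (cong (P₃ +_)
    (trans (∑-split o₃ L _ c) (cong (P₄ +_)
    (trans (∑-split o₄ L _ c) (cong (P₅ +_)
    (trans (∑-split o₅ D _ c) (cong (P₆ +_)
    (∑-split o₆ (L + L) _ c)))))))))))))
  P₇≡A+B : P₇ ≡ A + B
  P₇≡A+B = trans (∑-pairs L (λ j → c (o₆ + j)))
    (trans (sym (∑-reverse L (λ j → c (o₆ + pred (j + j)) + c (o₆ + (j + j)))))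
           (∑-distrib-+ L _ _))
  family₁ : P₁ + P₅ + B ≤ L * s
  family₁ = ∑₃-bounded L s _ _ _ λ _ j≤L → triple (triple₁-sum D j≤L)
  family₂ : P₃ + P₄ + A ≤ L * s
  family₂ = ∑₃-bounded L s _ _ _ λ _ j≤L → triple (triple₂-sum D j≤L)
  regroup : ∀ p₁ p₂ p₃ p₄ p₅ p₆ p₈ a b → p₁ + (p₂ + (p₃ + (p₄ + (p₅ + (p₆ + ((a + b) + p₈))))))
    ≡ (p₁ + p₅ + b) + (p₃ + p₄ + a) + (p₂ + p₆ + p₈)
  regroup = solve-∀
  total : ∀ L D m s → L * s + L * s + (1 * m + D * m + (3 * L + 3) * m) ≡ 2 * L * s + (3 * L + 4 + D) * m
  total = solve-∀

n≡9L+4+D : ∀ {n} → 4 ≤ n → ∃₂ λ L D → D ≤ 8 × n ≡ 9 * L + 4 + D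
n≡9L+4+D {n} 4≤n = L , D , ≤-pred (m%n<n (n ∸ 4) 9) , (begin
    n                 ≡⟨ sym (m+[n∸m]≡n 4≤n) ⟩
    4 + (n ∸ 4)       ≡⟨ cong (4 +_) (m≡m%n+[m/n]*n (n ∸ 4) 9) ⟩
    4 + (D + L * 9)   ≡⟨ rearrange L D ⟩
    9 * L + 4 + D     ∎)
  where
  open ≡-Reasoning
  L = (n ∸ 4) / 9
  D = (n ∸ 4) % 9
  rearrange : ∀ L D → 4 + (D + L * 9) ≡ 9 * L + 4 + D
  rearrange = solve-∀

seven-ninths-bound : ∀ L D m → D ≤ 8 →
  9 * (2 * L * (2 * m + 2) + (3 * L + 4 + D) * m) ≤ 7 * ((9 * L + 4 + D) * m) + 28 * ((9 * L + 4 + D) ⊔ m)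
seven-ninths-bound L D m D≤8 = begin
    9 * (2 * L * (2 * m + 2) + (3 * L + 4 + D) * m)
  ≡⟨ expand L D m ⟩
    7 * (n * m) + (2 * (D * m) + 8 * m + 36 * L)
  ≤⟨ +-monoʳ-≤ (7 * (n * m)) (begin
      2 * (D * m) + 8 * m + 36 * L
    ≤⟨ +-monoˡ-≤ (36 * L) (+-monoˡ-≤ (8 * m) (*-monoʳ-≤ 2 (*-monoˡ-≤ m D≤8))) ⟩
      2 * (8 * m) + 8 * m + 36 * L
    ≤⟨ m≤m+n _ (16 + 4 * D) ⟩
      2 * (8 * m) + 8 * m + 36 * L + (16 + 4 * D)
    ≡⟨ collect L D m ⟩
      24 * m + 4 * n
    ≤⟨ +-mono-≤ (*-monoʳ-≤ 24 (m≤n⊔m n m)) (*-monoʳ-≤ 4 (m≤m⊔n n m)) ⟩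
      24 * (n ⊔ m) + 4 * (n ⊔ m)
    ≡⟨ sym (*-distribʳ-+ (n ⊔ m) 24 4) ⟩
      28 * (n ⊔ m) ∎) ⟩
    7 * (n * m) + 28 * (n ⊔ m) ∎
  where
  open ≤-Reasoning
  n = 9 * L + 4 + D
  expand : ∀ L D m → 9 * (2 * L * (2 * m + 2) + (3 * L + 4 + D) * m)
    ≡ 7 * ((9 * L + 4 + D) * m) + (2 * (D * m) + 8 * m + 36 * L)
  expand = solve-∀
  collect : ∀ L D m → 2 * (8 * m) + 8 * m + 36 * L + (16 + 4 * D) ≡ 24 * m + 4 * (9 * L + 4 + D)
  collect = solve-∀

theorem3p3 : ∃₂ λ (C N : ℕ) → ∀ (n₁ n₂ : ℕ) → 1 ≤ n₁ → 1 ≤ n₂ → N ≤ n₁ → N ≤ n₂ →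
    ∀ (S : List Point) → Admissible3 n₁ n₂ S →
      9 * length S ≤ 7 * (n₁ * n₂) + C * (n₁ ⊔ n₂)
theorem3p3 = 28 , 4 , bound
  where
  bound : ∀ n₁ n₂ → 1 ≤ n₁ → 1 ≤ n₂ → 4 ≤ n₁ → 4 ≤ n₂ → ∀ S → Admissible3 n₁ n₂ S →
    9 * length S ≤ 7 * (n₁ * n₂) + 28 * (n₁ ⊔ n₂)
  bound n₁ n₂ _ _ 4≤n₁ _ S ((unique , S⊆grid) , avoids) with n≡9L+4+D 4≤n₁
  ... | L , D , D≤8 , refl = begin
      9 * length S
    ≡⟨ cong (9 *_) (sym (∑∑-multiplicity (9 * L + 4 + D) n₂ S⊆grid)) ⟩
      9 * ∑ (9 * L + 4 + D) column
    ≤⟨ *-monoʳ-≤ 9 (∑-triple-packing L D n₂ (2 * n₂ + 2) column column≤n₂ triple) ⟩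
      9 * (2 * L * (2 * n₂ + 2) + (3 * L + 4 + D) * n₂)
    ≤⟨ seven-ninths-bound L D n₂ D≤8 ⟩
      7 * ((9 * L + 4 + D) * n₂) + 28 * ((9 * L + 4 + D) ⊔ n₂) ∎
    where
    open ≤-Reasoning
    column : ℕ → ℕ
    column x = ∑[ y ≤ n₂ ] multiplicity S (x , y)
    column≤n₂ : ∀ x → column x ≤ n₂
    column≤n₂ x = ∑-indicator n₂ λ y → multiplicity-unique unique (x , y)
    triple : ∀ {i j k} → i + j + k ≡ 9 * L + 4 + D → column i + column j + column k ≤ 2 * n₂ + 2
    triple i+j+k≡n₁ = avoiding-∑-bound n₂ _ _ _
      (λ y → multiplicity-unique unique _) (λ y → multiplicity-unique unique _) (λ y → multiplicity-unique unique _)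
      λ a₁∈S a₂∈S a₃∈S y₁+y₂+y₃≡n₂ → avoids (multiplicity-∈ S a₁∈S) (multiplicity-∈ S a₂∈S) (multiplicity-∈ S a₃∈S)
        (cong₂ _,_ i+j+k≡n₁ y₁+y₂+y₃≡n₂)
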